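{- Let $\trianglelefteq$ be the relation on the set $\mathcal{F}(\mathbb{N}^2)$ of final segments of $\mathbb{N}^2$ defined by: $F\trianglelefteq G$ iff $F=G$ or there is $j\in\mathbb{N}$ with $F_i=G_i$ for all $i<j$ and $F_j\supsetneq G_j$, where $F_j=\{e\in\mathbb{N}:(e,j)\in F\}$. Then $\trianglelefteq$ is a well-ordering of $\mathcal{F}(\mathbb{N}^2)$ of order type $\omega^{\omega+1}+1$.
   Context: $\mathbb{N}^2$ carries the componentwise ordering; a final segment is a subset $F$ with $x\le y$, $x\in F\Rightarrow y\in F$. Each $F_j$ is a final segment of $\mathbb{N}$ and $F_0\subseteq F_1\subseteq\cdots$. -}

module Defs where

open import Level using (0ℓ; _⊔_)
open import Data.Nat using (ℕ; _≤_; _<_)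
open import Data.Product using (Σ; ∃; _×_; _,_; proj₁)
open import Data.Sum using (_⊎_)
open import Data.List using (List; []; _∷_)
open import Relation.Nullary using (¬_)
open import Data.Empty using (⊥)
open import Data.Unit using (⊤)
open import Relation.Binary.PropositionalEquality using (_≡_)
open import Relation.Unary using (Pred; _⊆_; _≐_)
open import Relation.Binary.Core using (Rel)
open import Relation.Binary.Structures using (IsTotalOrder)
open import Induction.WellFounded using (WellFounded)

_≤²_ : ℕ × ℕ → ℕ × ℕ → Set
(a , b) ≤² (c , d) = (a ≤ c) × (b ≤ d)

IsFinalSegment : Pred (ℕ × ℕ) 0ℓ → Set
IsFinalSegment F = ∀ {x y} → x ≤² y → F x → F y

FinalSeg : Set₁
FinalSeg = Σ (Pred (ℕ × ℕ) 0ℓ) IsFinalSegment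

_≐F_ : Rel FinalSeg 0ℓ
F ≐F G = proj₁ F ≐ proj₁ G

row : FinalSeg → ℕ → Pred ℕ 0ℓ
row F j e = proj₁ F (e , j)

_⊋_ : Pred ℕ 0ℓ → Pred ℕ 0ℓ → Set
A ⊋ B = (B ⊆ A) × ¬ (A ⊆ B)

_⊴_ : Rel FinalSeg 0ℓ
F ⊴ G = (F ≐F G) ⊎ ∃ λ j → (∀ i → i < j → row F i ≐ row G i) × (row F j ⊋ row G j)

StrictPart : ∀ {a} {A : Set a} → Rel A 0ℓ → Rel A 0ℓ → Rel A 0ℓ
StrictPart _≈_ _≤_ x y = (x ≤ y) × ¬ (x ≈ y)

IsWellOrder : ∀ {a} {A : Set a} → Rel A 0ℓ → Rel A 0ℓ → Set _
IsWellOrder _≈_ _≤_ = IsTotalOrder _≈_ _≤_ × WellFounded (StrictPart _≈_ _≤_)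

-- The ordinal ω^(ω+1) + 1, in Cantor normal form.
-- Ordinals < ω^(ω+1) are  ω^e₁ + ... + ω^eₖ  with e₁ ≥ ... ≥ eₖ and each
-- eᵢ < ω+1; the extra top element is ω^(ω+1) itself.

data Exp : Set where
  fin : ℕ → Exp
  ω   : Exp

data _<E_ : Exp → Exp → Set where
  fin<fin : ∀ {m n} → m < n → fin m <E fin n
  fin<ω   : ∀ {m} → fin m <E ω

_≤E_ : Exp → Exp → Set
e ≤E f = (e ≡ f) ⊎ (e <E f)

data Desc : List Exp → Set where
  []  : Desc []
  [_] : ∀ e → Desc (e ∷ [])
  _∷_ : ∀ {e f es} → f ≤E e → Desc (f ∷ es) → Desc (e ∷ f ∷ es)

-- lexicographic order on CNF = ordinal order
data _<L_ : List Exp → List Exp → Set where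
  []<∷  : ∀ {e es} → [] <L (e ∷ es)
  head< : ∀ {e f es fs} → e <E f → (e ∷ es) <L (f ∷ fs)
  tail< : ∀ {e es fs} → es <L fs → (e ∷ es) <L (e ∷ fs)

data Ord : Set where
  cnf : (es : List Exp) → Desc es → Ord
  top : Ord

_≈O_ : Rel Ord 0ℓ
cnf es _ ≈O cnf fs _ = es ≡ fs
cnf _ _  ≈O top      = ⊥
top      ≈O cnf _ _  = ⊥
top      ≈O top      = ⊤

_≤O_ : Rel Ord 0ℓ
cnf es _ ≤O cnf fs _ = (es ≡ fs) ⊎ (es <L fs)
cnf _ _  ≤O top      = ⊤
top      ≤O cnf _ _  = ⊥
top      ≤O top      = ⊤

record OrderIso {a b} {A : Set a} {B : Set b}
                (_≈_ : Rel A 0ℓ) (_≤_ : Rel A 0ℓ)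
                (_≈′_ : Rel B 0ℓ) (_≤′_ : Rel B 0ℓ) : Set (a ⊔ b) where
  field
    to       : A → B
    from     : B → A
    to-from  : ∀ y → to (from y) ≈′ y
    from-to  : ∀ x → from (to x) ≈ x
    mono     : ∀ {x y} → x ≤ y → to x ≤′ to y
    reflects : ∀ {x y} → to x ≤′ to y → x ≤ y

{-# OPTIONS --safe #-}
-- A final segment F is determined by its row minima s j = min F_j, with s j = ∞ for an empty
-- row; since the rows grow with j, s is non-increasing, and F ⊴ G says exactly that s_F
-- precedes s_G lexicographically.  A non-increasing sequence in ℕ ∪ {∞} is either constantly ∞
-- (F = ∅, the top element ω^(ω+1)) or of the form (e₁ + 1, …, eₖ₋₁ + 1, eₖ, eₖ, …), reading
-- ω + 1 as ∞, for a unique Cantor normal form ω^e₁ + ⋯ + ω^eₖ with eₖ finite, and this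
-- correspondence is lexicographic on both sides.  It remains to enumerate the normal forms with
-- a finite exponent, in order, by all normal forms.  Excluded middle is used to find the row
-- minima and to decide whether a sequence ever leaves a given value.
module Submission where

open import Defs
open import Level using (0ℓ)
open import Axiom.ExcludedMiddle using (ExcludedMiddle)
open import Data.Empty using (⊥; ⊥-elim)
open import Data.List using (List; []; _∷_)
open import Data.Nat using (ℕ; zero; suc; _≤_; _<_; z≤n; s≤s)
open import Data.Nat.Induction using (<-wellFounded; <-rec)
open import Data.Nat.Properties
  using (≤-refl; ≤-trans; <-trans; <-cmp; <-irrefl; <⇒≤; <⇒≱; ≰⇒>; n≤1+n; m≤n⇒m≤1+n;
         m≤n⇒m<n∨m≡n)
open import Data.Product using (∃; ∃₂; _×_; _,_; proj₁; proj₂)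
open import Data.Sum using (_⊎_; inj₁; inj₂)
import Data.Sum as Sum
open import Data.Unit using (⊤; tt)
open import Function using (_∘_)
open import Induction.WellFounded
  using (WellFounded; WfRec; Acc; acc; module All; module Subrelation)
import Relation.Binary.Construct.On as On
open import Relation.Binary.Core using (Rel)
open import Relation.Binary.Definitions using (tri<; tri≈; tri>)
open import Relation.Binary.PropositionalEquality
  using (_≡_; _≢_; refl; sym; cong; subst; _≗_)
open import Relation.Binary.Structures
  using (IsStrictPartialOrder; IsPartialOrder; IsTotalOrder)
open import Relation.Nullary using (¬_; yes; no)
open import Relation.Nullary.Decidable using (decidable-stable)
open import Relation.Unary using (Pred; _⊆_; _≐_)
open import Relation.Unary.Properties
  using (≐-refl; ≐-sym; ≐-trans; ⊂-trans; ⊂-irrefl; ⊂-respˡ-≐; ⊂-respʳ-≐)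

<E-irrefl : ∀ {e} → ¬ e <E e
<E-irrefl (fin<fin n<n) = <-irrefl refl n<n

<E-trichotomy : ∀ e f → e ≡ f ⊎ e <E f ⊎ f <E e
<E-trichotomy (fin m) (fin n) with <-cmp m n
... | tri< m<n _ _ = inj₂ (inj₁ (fin<fin m<n))
... | tri≈ _ refl _ = inj₁ refl
... | tri> _ _ n<m = inj₂ (inj₂ (fin<fin n<m))
<E-trichotomy (fin _) ω = inj₂ (inj₁ fin<ω)
<E-trichotomy ω (fin _) = inj₂ (inj₂ fin<ω)
<E-trichotomy ω ω = inj₁ refl

fin-acc : ∀ {n} → Acc _<_ n → Acc _<E_ (fin n)
fin-acc (acc rs) = acc λ { (fin<fin m<n) → fin-acc (rs m<n) }

<E-wellFounded : WellFounded _<E_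
<E-wellFounded (fin n) = fin-acc (<-wellFounded n)
<E-wellFounded ω = acc λ { (fin<ω {m}) → fin-acc (<-wellFounded m) }

0≤E : ∀ e → fin 0 ≤E e
0≤E (fin zero) = inj₁ refl
0≤E (fin (suc n)) = inj₂ (fin<fin (s≤s z≤n))
0≤E ω = inj₂ fin<ω

≤E-ω : ∀ e → e ≤E ω
≤E-ω (fin _) = inj₂ fin<ω
≤E-ω ω = inj₁ refl

≤E-fin⁻¹ : ∀ {e a} → e ≤E fin a → ∃ λ b → e ≡ fin b × b ≤ a
≤E-fin⁻¹ (inj₁ refl) = _ , refl , ≤-refl
≤E-fin⁻¹ (inj₂ (fin<fin b<a)) = _ , refl , <⇒≤ b<a

≤E-fin-weaken : ∀ {e a b} → e ≤E fin a → a ≤ b → e ≤E fin b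
≤E-fin-weaken e≤a a≤b with ≤E-fin⁻¹ e≤a
... | c , refl , c≤a with m≤n⇒m<n∨m≡n (≤-trans c≤a a≤b)
...   | inj₁ c<b = inj₂ (fin<fin c<b)
...   | inj₂ refl = inj₁ refl

HeadLE : Exp → List Exp → Set
HeadLE e [] = ⊤
HeadLE e (f ∷ _) = f ≤E e

HeadLE-ω : ∀ es → HeadLE ω es
HeadLE-ω [] = tt
HeadLE-ω (e ∷ _) = ≤E-ω e

HeadLE-weaken : ∀ {a b} es → HeadLE (fin a) es → a ≤ b → HeadLE (fin b) es
HeadLE-weaken [] _ _ = tt
HeadLE-weaken (_ ∷ _) e≤a a≤b = ≤E-fin-weaken e≤a a≤b

Desc-head : ∀ {e es} → Desc (e ∷ es) → HeadLE e es
Desc-head [ _ ] = tt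
Desc-head (f≤e ∷ _) = f≤e

Desc-tail : ∀ {e es} → Desc (e ∷ es) → Desc es
Desc-tail [ _ ] = []
Desc-tail (_ ∷ d) = d

Desc-cons : ∀ {e es} → HeadLE e es → Desc es → Desc (e ∷ es)
Desc-cons _ [] = [ _ ]
Desc-cons f≤e [ _ ] = f≤e ∷ [ _ ]
Desc-cons f≤e (g≤f ∷ d) = f≤e ∷ g≤f ∷ d

<L-irrefl : ∀ {es} → ¬ es <L es
<L-irrefl (head< e<e) = <E-irrefl e<e
<L-irrefl (tail< es<es) = <L-irrefl es<es

<L-trichotomy : ∀ es fs → es ≡ fs ⊎ es <L fs ⊎ fs <L es
<L-trichotomy [] [] = inj₁ refl
<L-trichotomy [] (_ ∷ _) = inj₂ (inj₁ []<∷)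
<L-trichotomy (_ ∷ _) [] = inj₂ (inj₂ []<∷)
<L-trichotomy (e ∷ es) (f ∷ fs) with <E-trichotomy e f
... | inj₂ (inj₁ e<f) = inj₂ (inj₁ (head< e<f))
... | inj₂ (inj₂ f<e) = inj₂ (inj₂ (head< f<e))
... | inj₁ refl with <L-trichotomy es fs
...   | inj₁ refl = inj₁ refl
...   | inj₂ (inj₁ es<fs) = inj₂ (inj₁ (tail< es<fs))
...   | inj₂ (inj₂ fs<es) = inj₂ (inj₂ (tail< fs<es))

data _<O_ : Rel Ord 0ℓ where
  cnf<cnf : ∀ {es fs d d′} → es <L fs → cnf es d <O cnf fs d′
  cnf<top : ∀ {es d} → cnf es d <O top

<O-trichotomy : ∀ x y → x ≈O y ⊎ x <O y ⊎ y <O x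
<O-trichotomy (cnf es _) (cnf fs _) = Sum.map₂ (Sum.map cnf<cnf cnf<cnf) (<L-trichotomy es fs)
<O-trichotomy (cnf _ _) top = inj₂ (inj₁ cnf<top)
<O-trichotomy top (cnf _ _) = inj₂ (inj₂ cnf<top)
<O-trichotomy top top = inj₁ tt

<O⇒≤O : ∀ {x y} → x <O y → x ≤O y
<O⇒≤O (cnf<cnf es<fs) = inj₂ es<fs
<O⇒≤O cnf<top = tt

≈O⇒≤O : ∀ {x y} → x ≈O y → x ≤O y
≈O⇒≤O {cnf _ _} {cnf _ _} es≡fs = inj₁ es≡fs
≈O⇒≤O {top} {top} _ = tt

≤O⇒≈O⊎<O : ∀ {x y} → x ≤O y → x ≈O y ⊎ x <O y
≤O⇒≈O⊎<O {cnf _ _} {cnf _ _} (inj₁ es≡fs) = inj₁ es≡fs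
≤O⇒≈O⊎<O {cnf _ _} {cnf _ _} (inj₂ es<fs) = inj₂ (cnf<cnf es<fs)
≤O⇒≈O⊎<O {cnf _ _} {top} _ = inj₂ cnf<top
≤O⇒≈O⊎<O {top} {top} _ = inj₁ tt

≤O-total : ∀ x y → x ≤O y ⊎ y ≤O x
≤O-total x y with <O-trichotomy x y
... | inj₁ x≈y = inj₁ (≈O⇒≤O {x} {y} x≈y)
... | inj₂ (inj₁ x<y) = inj₁ (<O⇒≤O x<y)
... | inj₂ (inj₂ y<x) = inj₂ (<O⇒≤O y<x)

AccBelow : Exp → Set
AccBelow e = ∀ es (d : Desc es) → HeadLE e es → Acc _<O_ (cnf es d)

acc-[] : ∀ d → Acc _<O_ (cnf [] d)
acc-[] _ = acc λ { (cnf<cnf ()) }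

module _ {e : Exp} (ih : WfRec _<E_ AccBelow e) where

  acc-∷ : ∀ {es d₀} → Acc _<O_ (cnf es d₀) → ∀ d → Acc _<O_ (cnf (e ∷ es) d)
  acc-∷ (acc rs) _ = acc λ where
    (cnf<cnf {d = d} []<∷) → acc-[] d
    (cnf<cnf {f ∷ ys} {d = d} (head< f<e)) → ih f<e (f ∷ ys) d (inj₁ refl)
    (cnf<cnf {d = d} (tail< ys<es)) → acc-∷ (rs (cnf<cnf {d = Desc-tail d} ys<es)) d

  accBelow : AccBelow e
  accBelow [] d _ = acc-[] d
  accBelow (f ∷ es) d (inj₂ f<e) = ih f<e (f ∷ es) d (inj₁ refl)
  accBelow (.e ∷ es) d (inj₁ refl) = acc-∷ (accBelow es (Desc-tail d) (Desc-head d)) d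

acc-cnf : ∀ es d → Acc _<O_ (cnf es d)
acc-cnf [] d = acc-[] d
acc-cnf (e ∷ es) d =
  All.wfRec <E-wellFounded 0ℓ AccBelow (λ _ → accBelow) e (e ∷ es) d (inj₁ refl)

<O-wellFounded : WellFounded _<O_
<O-wellFounded (cnf es d) = acc-cnf es d
<O-wellFounded top = acc λ { (cnf<top {es} {d}) → acc-cnf es d }

HasFin : List Exp → Set
HasFin [] = ⊥
HasFin (fin _ ∷ _) = ⊤
HasFin (ω ∷ es) = HasFin es

IsCode : List Exp → Set
IsCode L = Desc L × HasFin L

IsCode-tail : ∀ {c e L} → IsCode (fin c ∷ e ∷ L) → IsCode (e ∷ L)
IsCode-tail (inj₁ refl ∷ d , _) = d , tt
IsCode-tail (inj₂ (fin<fin _) ∷ d , _) = d , tt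

-- The codes are the ordinals below ω^(ω+1) other than ω^ω·m (m ≥ 0).  code maps ω^ω·m + n
-- to ω^ω·m + n + 1 and fixes every other ordinal, so it enumerates the codes in order.
code : List Exp → List Exp
codeTail : Exp → List Exp → List Exp

code [] = fin 0 ∷ []
code (e ∷ es) = e ∷ codeTail e es

codeTail ω es = code es
codeTail (fin zero) es = code es
codeTail (fin (suc _)) es = es

[]<code : ∀ es → [] <L code es
[]<code [] = []<∷
[]<code (_ ∷ _) = []<∷

code-strictMono : ∀ {es fs} → es <L fs → code es <L code fs
code-strictMono {fs = ω ∷ _} []<∷ = head< fin<ω
code-strictMono {fs = fin zero ∷ fs} []<∷ = tail< ([]<code fs)
code-strictMono {fs = fin (suc _) ∷ _} []<∷ = head< (fin<fin (s≤s z≤n))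
code-strictMono (head< e<f) = head< e<f
code-strictMono {ω ∷ _} (tail< es<fs) = tail< (code-strictMono es<fs)
code-strictMono {fin zero ∷ _} (tail< es<fs) = tail< (code-strictMono es<fs)
code-strictMono {fin (suc _) ∷ _} (tail< es<fs) = tail< es<fs

HeadLE-code : ∀ {e} es → HeadLE e es → HeadLE e (code es)
HeadLE-code {e} [] _ = 0≤E e
HeadLE-code (_ ∷ _) f≤e = f≤e

HeadLE-code⁻¹ : ∀ {e} es → HeadLE e (code es) → HeadLE e es
HeadLE-code⁻¹ [] _ = tt
HeadLE-code⁻¹ (_ ∷ _) f≤e = f≤e

code-Desc : ∀ {es} → Desc es → Desc (code es)
code-Desc {[]} _ = [ fin 0 ]
code-Desc {ω ∷ es} d = Desc-cons (HeadLE-ω (code es)) (code-Desc (Desc-tail d))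
code-Desc {fin zero ∷ es} d = Desc-cons (HeadLE-code es (Desc-head d)) (code-Desc (Desc-tail d))
code-Desc {fin (suc _) ∷ _} d = d

code-HasFin : ∀ es → HasFin (code es)
code-HasFin [] = tt
code-HasFin (ω ∷ es) = code-HasFin es
code-HasFin (fin zero ∷ _) = tt
code-HasFin (fin (suc _) ∷ _) = tt

code-IsCode : ∀ {es} → Desc es → IsCode (code es)
code-IsCode {es} d = code-Desc d , code-HasFin es

code-surjective : ∀ {L} → IsCode L → ∃ λ es → Desc es × code es ≡ L
code-surjective {[]} (_ , ())
code-surjective {ω ∷ []} (_ , ())
code-surjective {ω ∷ _ ∷ _} (_ ∷ d , hasFin) with code-surjective (d , hasFin)
... | es , des , code≡ = ω ∷ es , Desc-cons (HeadLE-ω es) des , cong (ω ∷_) code≡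
code-surjective {fin zero ∷ []} _ = [] , [] , refl
code-surjective {fin zero ∷ _ ∷ _} isCode@(e≤0 ∷ _ , _) with code-surjective (IsCode-tail isCode)
... | es , des , code≡ = fin 0 ∷ es , Desc-cons es≤0 des , cong (fin 0 ∷_) code≡
  where
  es≤0 : HeadLE (fin 0) es
  es≤0 = HeadLE-code⁻¹ es (subst (HeadLE (fin 0)) (sym code≡) e≤0)
code-surjective {fin (suc k) ∷ L} (d , _) = fin (suc k) ∷ L , d , refl

data ℕ∞ : Set where
  val : ℕ → ℕ∞
  ∞   : ℕ∞

data _≤∞_ : Rel ℕ∞ 0ℓ where
  val≤val : ∀ {a b} → a ≤ b → val a ≤∞ val b
  ≤∞-top  : ∀ {x} → x ≤∞ ∞

data _<∞_ : Rel ℕ∞ 0ℓ where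
  val<val : ∀ {a b} → a < b → val a <∞ val b
  val<∞   : ∀ {a} → val a <∞ ∞

≤∞-refl : ∀ {x} → x ≤∞ x
≤∞-refl {val _} = val≤val ≤-refl
≤∞-refl {∞} = ≤∞-top

≤∞-trans : ∀ {x y z} → x ≤∞ y → y ≤∞ z → x ≤∞ z
≤∞-trans (val≤val a≤b) (val≤val b≤c) = val≤val (≤-trans a≤b b≤c)
≤∞-trans _ ≤∞-top = ≤∞-top

<⇒≤∞ : ∀ {x y} → x <∞ y → x ≤∞ y
<⇒≤∞ (val<val a<b) = val≤val (<⇒≤ a<b)
<⇒≤∞ val<∞ = ≤∞-top

<∞⇒≱ : ∀ {x y} → x <∞ y → ¬ y ≤∞ x
<∞⇒≱ (val<val a<b) (val≤val b≤a) = <⇒≱ a<b b≤a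
<∞⇒≱ val<∞ ()

≤∞-val⁻¹ : ∀ {x a} → x ≤∞ val a → x ≡ val a ⊎ ∃ λ b → x ≡ val b × b < a
≤∞-val⁻¹ (val≤val b≤a) with m≤n⇒m<n∨m≡n b≤a
... | inj₁ b<a = inj₂ (_ , refl , b<a)
... | inj₂ refl = inj₁ refl

≢val⇒≡∞ : ∀ {x} → (∀ a → x ≢ val a) → x ≡ ∞
≢val⇒≡∞ {val a} x≢val = ⊥-elim (x≢val a refl)
≢val⇒≡∞ {∞} _ = refl

Seq : Set
Seq = ℕ → ℕ∞

NonIncreasing : Seq → Set
NonIncreasing s = ∀ j → s (suc j) ≤∞ s j

antitone : ∀ {s} → NonIncreasing s → ∀ {i j} → i ≤ j → s j ≤∞ s i
antitone s↓ {i} {j} i≤j with m≤n⇒m<n∨m≡n i≤j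
... | inj₂ refl = ≤∞-refl
antitone s↓ {i} {suc j} _ | inj₁ (s≤s i≤j) = ≤∞-trans (s↓ j) (antitone s↓ i≤j)

Lex : ∀ {a} {A : Set a} → Rel A 0ℓ → Rel A 0ℓ → Rel (ℕ → A) 0ℓ
Lex _≈_ _≺_ f g = ∃ λ j → (∀ i → i < j → f i ≈ g i) × f j ≺ g j

module _ {a} {A : Set a} {_≈_ _≺_ : Rel A 0ℓ} (spo : IsStrictPartialOrder _≈_ _≺_) where
  open IsStrictPartialOrder spo

  Lex-irrefl : ∀ {f g} → Lex _≈_ _≺_ f g → ¬ (∀ i → f i ≈ g i)
  Lex-irrefl (j , _ , fj<gj) f≈g = irrefl (f≈g j) fj<gj

  Lex-resp : ∀ {f f′ g g′} → (∀ i → f i ≈ f′ i) → (∀ i → g i ≈ g′ i) →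
             Lex _≈_ _≺_ f g → Lex _≈_ _≺_ f′ g′
  Lex-resp f≈f′ g≈g′ (j , eq , fj<gj) =
    j , (λ i i<j → Eq.trans (Eq.sym (f≈f′ i)) (Eq.trans (eq i i<j) (g≈g′ i))) ,
    <-respʳ-≈ (g≈g′ j) (<-respˡ-≈ (f≈f′ j) fj<gj)

  Lex-trans : ∀ {f g h} → Lex _≈_ _≺_ f g → Lex _≈_ _≺_ g h → Lex _≈_ _≺_ f h
  Lex-trans (j , eq₁ , fj<gj) (k , eq₂ , gk<hk) with <-cmp j k
  ... | tri< j<k _ _ =
    j , (λ i i<j → Eq.trans (eq₁ i i<j) (eq₂ i (<-trans i<j j<k))) , <-respʳ-≈ (eq₂ j j<k) fj<gj
  ... | tri≈ _ refl _ = j , (λ i i<j → Eq.trans (eq₁ i i<j) (eq₂ i i<j)) , trans fj<gj gk<hk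
  ... | tri> _ _ k<j =
    k , (λ i i<k → Eq.trans (eq₁ i (<-trans i<k k<j)) (eq₂ i i<k)) ,
    <-respˡ-≈ (Eq.sym (eq₁ k k<j)) gk<hk

  Lex-asym : ∀ {f g} → Lex _≈_ _≺_ f g → ¬ Lex _≈_ _≺_ g f
  Lex-asym (j , eq₁ , fj<gj) (k , eq₂ , gk<fk) with <-cmp j k
  ... | tri< j<k _ _ = irrefl (Eq.sym (eq₂ j j<k)) fj<gj
  ... | tri≈ _ refl _ = asym fj<gj gk<fk
  ... | tri> _ _ k<j = irrefl (Eq.sym (eq₁ k k<j)) gk<fk

_<ˢ_ : Rel Seq 0ℓ
_<ˢ_ = Lex _≡_ _<∞_

<ˢ-here : ∀ {s t} → s 0 <∞ t 0 → s <ˢ t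
<ˢ-here s0<t0 = 0 , (λ _ ()) , s0<t0

<ˢ-cons : ∀ {s t} → s 0 ≡ t 0 → (s ∘ suc) <ˢ (t ∘ suc) → s <ˢ t
<ˢ-cons s0≡t0 (j , eq , sj<tj) =
  suc j , (λ { zero _ → s0≡t0 ; (suc i) (s≤s i<j) → eq i i<j }) , sj<tj

-- The clause for [] is junk: [] is not a code.
decode : List Exp → Seq
decode [] _ = val 0
decode (ω ∷ _) zero = ∞
decode (ω ∷ L) (suc j) = decode L j
decode (fin c ∷ []) _ = val c
decode (fin c ∷ _ ∷ _) zero = val (suc c)
decode (fin _ ∷ e ∷ L) (suc j) = decode (e ∷ L) j

decode-head-≤ : ∀ {e c} L → e ≤E fin c → decode (e ∷ L) 0 ≤∞ val (suc c)
decode-head-≤ L e≤c with ≤E-fin⁻¹ e≤c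
decode-head-≤ [] _ | _ , refl , b≤c = val≤val (m≤n⇒m≤1+n b≤c)
decode-head-≤ (_ ∷ _) _ | _ , refl , b≤c = val≤val (s≤s b≤c)

decode-nonIncreasing : ∀ {L} → IsCode L → NonIncreasing (decode L)
decode-nonIncreasing {[]} (_ , ())
decode-nonIncreasing {ω ∷ []} (_ , ())
decode-nonIncreasing {ω ∷ _ ∷ _} _ zero = ≤∞-top
decode-nonIncreasing {ω ∷ _ ∷ _} (_ ∷ d , hasFin) (suc j) =
  decode-nonIncreasing (d , hasFin) j
decode-nonIncreasing {fin _ ∷ []} _ _ = ≤∞-refl
decode-nonIncreasing {fin _ ∷ _ ∷ L} (e≤c ∷ _ , _) zero = decode-head-≤ L e≤c
decode-nonIncreasing {fin _ ∷ _ ∷ _} isCode (suc j) =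
  decode-nonIncreasing (IsCode-tail isCode) j

decode-<ˢ-const : ∀ {e a} L → IsCode (e ∷ L) → e ≤E fin a →
                  decode (e ∷ L) <ˢ (λ _ → val (suc a))
decode-<ˢ-const L isCode e≤a with ≤E-fin⁻¹ e≤a
decode-<ˢ-const [] _ _ | _ , refl , b≤a = <ˢ-here (val<val (s≤s b≤a))
decode-<ˢ-const (_ ∷ L) isCode@(e≤b ∷ _ , _) _ | _ , refl , b≤a with m≤n⇒m<n∨m≡n b≤a
... | inj₁ b<a = <ˢ-here (val<val (s≤s b<a))
... | inj₂ refl = <ˢ-cons refl (decode-<ˢ-const L (IsCode-tail isCode) e≤b)

decode-<ˢ-∞ : ∀ {L} → IsCode L → decode L <ˢ (λ _ → ∞)
decode-<ˢ-∞ {[]} (_ , ())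
decode-<ˢ-∞ {ω ∷ []} (_ , ())
decode-<ˢ-∞ {ω ∷ _ ∷ _} (_ ∷ d , hasFin) = <ˢ-cons refl (decode-<ˢ-∞ (d , hasFin))
decode-<ˢ-∞ {fin _ ∷ []} _ = <ˢ-here val<∞
decode-<ˢ-∞ {fin _ ∷ _ ∷ _} _ = <ˢ-here val<∞

decode-strictMono : ∀ {L M} → IsCode L → IsCode M → L <L M → decode L <ˢ decode M
decode-strictMono (_ , ()) _ []<∷
decode-strictMono {fin _ ∷ []} _ _ (head< fin<ω) = <ˢ-here val<∞
decode-strictMono {fin _ ∷ _ ∷ _} _ _ (head< fin<ω) = <ˢ-here val<∞
decode-strictMono {fin _ ∷ []} {fin _ ∷ []} _ _ (head< (fin<fin a<b)) =
  <ˢ-here (val<val a<b)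
decode-strictMono {fin _ ∷ []} {fin _ ∷ _ ∷ _} _ _ (head< (fin<fin a<b)) =
  <ˢ-here (val<val (m≤n⇒m≤1+n a<b))
decode-strictMono {fin _ ∷ _ ∷ _} {fin _ ∷ _ ∷ _} _ _ (head< (fin<fin a<b)) =
  <ˢ-here (val<val (s≤s a<b))
decode-strictMono {fin _ ∷ _ ∷ es} {fin _ ∷ []} isCode@(e≤a ∷ _ , _) _ (head< (fin<fin a<b))
  with m≤n⇒m<n∨m≡n a<b
... | inj₁ a+1<b = <ˢ-here (val<val a+1<b)
... | inj₂ refl = <ˢ-cons refl (decode-<ˢ-const es (IsCode-tail isCode) e≤a)
decode-strictMono {ω ∷ []} (_ , ()) _ (tail< _)
decode-strictMono {ω ∷ _ ∷ _} {ω ∷ []} _ (_ , ()) (tail< _)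
decode-strictMono {ω ∷ _ ∷ _} {ω ∷ _ ∷ _} (_ ∷ d , hasFin) (_ ∷ d′ , hasFin′) (tail< L<M) =
  <ˢ-cons refl (decode-strictMono (d , hasFin) (d′ , hasFin′) L<M)
decode-strictMono {fin _ ∷ []} {fin _ ∷ _ ∷ _} _ _ (tail< _) = <ˢ-here (val<val ≤-refl)
decode-strictMono {fin _ ∷ _ ∷ _} {fin _ ∷ _ ∷ _} isCode isCode′ (tail< L<M) =
  <ˢ-cons refl (decode-strictMono (IsCode-tail isCode) (IsCode-tail isCode′) L<M)

Codes : List Exp → Seq → Set
Codes L s = IsCode L × decode L ≗ s

codes-const : ∀ {a s} → (∀ j → s j ≡ val a) → Codes (fin a ∷ []) s
codes-const {a} s≡a = ([ fin a ] , tt) , λ j → sym (s≡a j)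

codes-fin∷ : ∀ {c L s} → HeadLE (fin c) L → s 0 ≡ val (suc c) → Codes L (s ∘ suc) →
             Codes (fin c ∷ L) s
codes-fin∷ {L = []} _ _ ((_ , ()) , _)
codes-fin∷ {L = _ ∷ _} e≤c s0 ((d , _) , decode≗) =
  (e≤c ∷ d , tt) , λ { zero → sym s0 ; (suc j) → decode≗ j }

codes-ω∷ : ∀ {L s} → s 0 ≡ ∞ → Codes L (s ∘ suc) → Codes (ω ∷ L) s
codes-ω∷ {L = []} _ ((_ , ()) , _)
codes-ω∷ {L = e ∷ _} s0 ((d , hasFin) , decode≗) =
  (≤E-ω e ∷ d , hasFin) , λ { zero → sym s0 ; (suc j) → decode≗ j }

Above : ℕ∞ → Pred ℕ 0ℓ
Above x e = x ≤∞ val e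

Above-strict : ∀ {x y} → x <∞ y → Above x ⊋ Above y
Above-strict {val _} x<y = ≤∞-trans (<⇒≤∞ x<y) , λ Ax⊆Ay → <∞⇒≱ x<y (Ax⊆Ay ≤∞-refl)
Above-strict {∞} ()

Above-<ˢ : ∀ {s t} → s <ˢ t → Lex _≐_ _⊋_ (Above ∘ s) (Above ∘ t)
Above-<ˢ (j , eq , sj<tj) = j , (λ i i<j → Above-cong (eq i i<j)) , Above-strict sj<tj
  where
  Above-cong : ∀ {x y} → x ≡ y → Above x ≐ Above y
  Above-cong refl = ≐-refl

Above-⊆⇒≥ : ∀ {x y} → Above x ⊆ Above y → y ≤∞ x
Above-⊆⇒≥ {val _} Ax⊆Ay = Ax⊆Ay ≤∞-refl
Above-⊆⇒≥ {∞} _ = ≤∞-top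

epigraph : (s : Seq) → NonIncreasing s → FinalSeg
epigraph s s↓ =
  (λ (e , j) → Above (s j) e) ,
  λ (a≤c , b≤d) sb≤a → ≤∞-trans (antitone s↓ b≤d) (≤∞-trans sb≤a (val≤val a≤c))

⊋-isStrictPartialOrder : IsStrictPartialOrder {A = Pred ℕ 0ℓ} _≐_ _⊋_
⊋-isStrictPartialOrder = record
  { isEquivalence = record { refl = ≐-refl ; sym = ≐-sym ; trans = ≐-trans }
  ; irrefl = λ P≐Q P⊋Q → ⊂-irrefl (≐-sym P≐Q) P⊋Q
  ; trans = λ P⊋Q Q⊋R → ⊂-trans Q⊋R P⊋Q
  ; <-resp-≈ = ⊂-respˡ-≐ , ⊂-respʳ-≐
  }

_◁_ : Rel FinalSeg 0ℓ
_◁_ = StrictPart _≐F_ _⊴_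

rows-≐ : ∀ {F G} → F ≐F G → ∀ j → row F j ≐ row G j
rows-≐ (F⊆G , G⊆F) _ = F⊆G , G⊆F

⊴-resp-≐F : ∀ {F F′ G G′} → F ≐F F′ → G ≐F G′ → F ⊴ G → F′ ⊴ G′
⊴-resp-≐F F≐F′ G≐G′ (inj₁ F≐G) = inj₁ (≐-trans (≐-sym F≐F′) (≐-trans F≐G G≐G′))
⊴-resp-≐F {F} {F′} {G} {G′} F≐F′ G≐G′ (inj₂ F<G) =
  inj₂ (Lex-resp ⊋-isStrictPartialOrder (rows-≐ {F} {F′} F≐F′) (rows-≐ {G} {G′} G≐G′) F<G)

⊴-trans : ∀ {F G H} → F ⊴ G → G ⊴ H → F ⊴ H
⊴-trans {F} {G} {H} (inj₁ F≐G) G⊴H = ⊴-resp-≐F {G} {F} {H} {H} (≐-sym F≐G) ≐-refl G⊴H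
⊴-trans {F} {G} {H} F⊴G (inj₁ G≐H) = ⊴-resp-≐F {F} {F} {G} {H} ≐-refl G≐H F⊴G
⊴-trans (inj₂ F<G) (inj₂ G<H) = inj₂ (Lex-trans ⊋-isStrictPartialOrder F<G G<H)

⊴-antisym : ∀ {F G} → F ⊴ G → G ⊴ F → F ≐F G
⊴-antisym (inj₁ F≐G) _ = F≐G
⊴-antisym _ (inj₁ G≐F) = ≐-sym G≐F
⊴-antisym (inj₂ F<G) (inj₂ G<F) = ⊥-elim (Lex-asym ⊋-isStrictPartialOrder F<G G<F)

⊴-isPartialOrder : IsPartialOrder _≐F_ _⊴_
⊴-isPartialOrder = record
  { isPreorder = record
    { isEquivalence = record { refl = ≐-refl ; sym = ≐-sym ; trans = ≐-trans }
    ; reflexive = inj₁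
    ; trans = λ {F} {G} {H} → ⊴-trans {F} {G} {H}
    }
  ; antisym = λ {F} {G} → ⊴-antisym {F} {G}
  }

row-⊆-suc : ∀ F j → row F j ⊆ row F (suc j)
row-⊆-suc F j = proj₂ F (≤-refl , n≤1+n j)

epigraph-cong : ∀ {s t} s↓ t↓ → s ≗ t → epigraph s s↓ ≐F epigraph t t↓
epigraph-cong _ _ s≗t =
  (λ {(e , j)} → subst (λ x → Above x e) (s≗t j)) ,
  (λ {(e , j)} → subst (λ x → Above x e) (sym (s≗t j)))

epigraph-strict : ∀ {s t} s↓ t↓ → s <ˢ t → epigraph s s↓ ◁ epigraph t t↓
epigraph-strict {s} {t} s↓ t↓ s<t =
  inj₂ (Above-<ˢ s<t) ,
  λ s≐t → Lex-irrefl ⊋-isStrictPartialOrder (Above-<ˢ s<t)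
                     (rows-≐ {epigraph s s↓} {epigraph t t↓} s≐t)

sequenceOf : Ord → Seq
sequenceOf (cnf es _) = decode (code es)
sequenceOf top _ = ∞

sequenceOf-nonIncreasing : ∀ x → NonIncreasing (sequenceOf x)
sequenceOf-nonIncreasing (cnf _ d) = decode-nonIncreasing (code-IsCode d)
sequenceOf-nonIncreasing top _ = ≤∞-top

sequenceOf-strictMono : ∀ {x y} → x <O y → sequenceOf x <ˢ sequenceOf y
sequenceOf-strictMono (cnf<cnf {d = d} {d′} es<fs) =
  decode-strictMono (code-IsCode d) (code-IsCode d′) (code-strictMono es<fs)
sequenceOf-strictMono (cnf<top {d = d}) = decode-<ˢ-∞ (code-IsCode d)

segmentOf : Ord → FinalSeg
segmentOf x = epigraph (sequenceOf x) (sequenceOf-nonIncreasing x)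

segmentOf-strict : ∀ {x y} → x <O y → segmentOf x ◁ segmentOf y
segmentOf-strict {x} {y} x<y =
  epigraph-strict (sequenceOf-nonIncreasing x) (sequenceOf-nonIncreasing y)
                  (sequenceOf-strictMono x<y)

segmentOf-cong : ∀ {x y} → x ≈O y → segmentOf x ≐F segmentOf y
segmentOf-cong {cnf _ _} {cnf _ _} refl = ≐-refl
segmentOf-cong {top} {top} _ = ≐-refl

segmentOf-mono : ∀ {x y} → x ≤O y → segmentOf x ⊴ segmentOf y
segmentOf-mono {x} {y} x≤y with ≤O⇒≈O⊎<O {x} {y} x≤y
... | inj₁ x≈y = inj₁ (segmentOf-cong {x} {y} x≈y)
... | inj₂ x<y = proj₁ (segmentOf-strict x<y)

segmentOf-injective : ∀ {x y} → segmentOf x ≐F segmentOf y → x ≈O y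
segmentOf-injective {x} {y} Sx≐Sy with <O-trichotomy x y
... | inj₁ x≈y = x≈y
... | inj₂ (inj₁ x<y) = ⊥-elim (proj₂ (segmentOf-strict x<y) Sx≐Sy)
... | inj₂ (inj₂ y<x) = ⊥-elim (proj₂ (segmentOf-strict y<x) (≐-sym Sx≐Sy))

segmentOf-reflects : ∀ {x y} → segmentOf x ⊴ segmentOf y → x ≤O y
segmentOf-reflects {x} {y} Sx⊴Sy with <O-trichotomy x y
... | inj₁ x≈y = ≈O⇒≤O {x} {y} x≈y
... | inj₂ (inj₁ x<y) = <O⇒≤O x<y
... | inj₂ (inj₂ y<x) with segmentOf-strict y<x
...   | Sy⊴Sx , Sy≉Sx = ⊥-elim (Sy≉Sx (≐-sym (⊴-antisym {segmentOf x} {segmentOf y} Sx⊴Sy Sy⊴Sx)))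

module Classical (lem : ExcludedMiddle 0ℓ) where

  minimum : ∀ {P : Pred ℕ 0ℓ} → (∀ {m n} → m ≤ n → P m → P n) →
            ∀ {n} → P n → ∃ λ m → P ≐ Above (val m)
  minimum up {zero} P0 = 0 , (λ _ → val≤val z≤n) , λ { (val≤val 0≤k) → up 0≤k P0 }
  minimum {P} up {suc n} P1+n with lem {P n}
  ... | yes Pn = minimum up Pn
  ... | no ¬Pn =
    suc n , (λ Pk → val≤val (≰⇒> λ k≤n → ¬Pn (up k≤n Pk))) , λ { (val≤val 1+n≤k) → up 1+n≤k P1+n }

  upClosed≐Above : ∀ {P : Pred ℕ 0ℓ} → (∀ {m n} → m ≤ n → P m → P n) → ∃ λ x → P ≐ Above x
  upClosed≐Above {P} up with lem {∃ P}
  ... | no empty = ∞ , (λ {e} Pe → ⊥-elim (empty (e , Pe))) , λ ()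
  ... | yes (_ , Pn) with minimum up Pn
  ...   | m , P≐m = val m , P≐m

  rowMin : FinalSeg → Seq
  rowMin F j = proj₁ (upClosed≐Above {row F j} λ m≤n → proj₂ F (m≤n , ≤-refl))

  row≐Above-rowMin : ∀ F j → row F j ≐ Above (rowMin F j)
  row≐Above-rowMin F j = proj₂ (upClosed≐Above {row F j} λ m≤n → proj₂ F (m≤n , ≤-refl))

  rowMin-nonIncreasing : ∀ F → NonIncreasing (rowMin F)
  rowMin-nonIncreasing F j = Above-⊆⇒≥ λ e∈Aj →
    proj₁ (row≐Above-rowMin F (suc j)) (row-⊆-suc F j (proj₂ (row≐Above-rowMin F j) e∈Aj))

  segmentOf≐ : ∀ {x F} → sequenceOf x ≗ rowMin F → segmentOf x ≐F F
  segmentOf≐ {x} {F} x≗F =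
    ≐-trans (epigraph-cong (sequenceOf-nonIncreasing x) (rowMin-nonIncreasing F) x≗F)
            ((λ {(_ , j)} → proj₂ (row≐Above-rowMin F j)) ,
             (λ {(_ , j)} → proj₁ (row≐Above-rowMin F j)))

  CodedBelow : ℕ → Seq → Set
  CodedBelow a s = ∃ λ L → HeadLE (fin a) L × Codes L s

  CodableFrom : ℕ → Set
  CodableFrom a = ∀ {s} → NonIncreasing s → s 0 ≡ val a → CodedBelow a s

  codedBelow-fin∷ : ∀ {c s} → s 0 ≡ val (suc c) → CodedBelow c (s ∘ suc) → CodedBelow c s
  codedBelow-fin∷ s0 (L , L≤c , codes) = _ , inj₁ refl , codes-fin∷ L≤c s0 codes

  codedBelow-drop : ∀ {c} → (∀ {b} → b ≤ c → CodableFrom b) → ∀ {s} → NonIncreasing s →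
                    s 0 ≡ val (suc c) → ∀ j → s j ≢ val (suc c) → CodedBelow c s
  codedBelow-drop _ _ s0 zero s0≢ = ⊥-elim (s0≢ s0)
  codedBelow-drop ih {s} s↓ s0 (suc j) sj≢ with ≤∞-val⁻¹ (subst (s 1 ≤∞_) s0 (s↓ 0))
  ... | inj₁ s1≡ = codedBelow-fin∷ s0 (codedBelow-drop ih (s↓ ∘ suc) s1≡ j sj≢)
  ... | inj₂ (b , s1≡b , s≤s b≤c) with ih b≤c (s↓ ∘ suc) s1≡b
  ...   | L , L≤b , codes = codedBelow-fin∷ s0 (L , HeadLE-weaken L L≤b b≤c , codes)

  codableFrom : ∀ a → CodableFrom a
  codableFrom = <-rec CodableFrom step
    where
    step : ∀ a → WfRec _<_ CodableFrom a → CodableFrom a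
    step a ih {s} s↓ s0 with lem {∃ λ j → s j ≢ val a}
    ... | no constant =
      fin a ∷ [] , inj₁ refl , codes-const λ j → decidable-stable lem λ sj≢a → constant (j , sj≢a)
    ... | yes (j , sj≢a) with ≤∞-val⁻¹ (subst (s j ≤∞_) s0 (antitone s↓ z≤n))
    ...   | inj₁ sj≡a = ⊥-elim (sj≢a sj≡a)
    step (suc c) ih s↓ s0 | yes (j , sj≢a) | inj₂ (_ , _ , s≤s _)
      with codedBelow-drop (λ b≤c → ih (s≤s b≤c)) s↓ s0 j sj≢a
    ... | L , L≤c , codes = L , HeadLE-weaken L L≤c (n≤1+n c) , codes

  coded : ∀ {s j a} → NonIncreasing s → s j ≡ val a → ∃ λ L → Codes L s
  coded {s} {zero} s↓ s0 = let L , _ , codes = codableFrom _ s↓ s0 in L , codes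
  coded {s} {suc j} s↓ sj with s 0 in s0
  ... | val b = let L , _ , codes = codableFrom b s↓ s0 in L , codes
  ... | ∞ = let L , codes = coded (s↓ ∘ suc) sj in ω ∷ L , codes-ω∷ s0 codes

  empty-or-coded : ∀ {s} → NonIncreasing s → (∀ j → s j ≡ ∞) ⊎ ∃ λ L → Codes L s
  empty-or-coded {s} s↓ with lem {∃₂ λ j a → s j ≡ val a}
  ... | yes (_ , _ , sj≡a) = inj₂ (coded s↓ sj≡a)
  ... | no neverFinite = inj₁ λ j → ≢val⇒≡∞ λ a sj≡a → neverFinite (j , a , sj≡a)

  segmentOf-surjective : ∀ F → ∃ λ x → segmentOf x ≐F F
  segmentOf-surjective F with empty-or-coded (rowMin-nonIncreasing F)
  ... | inj₁ allEmpty = top , segmentOf≐ {top} {F} (λ j → sym (allEmpty j))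
  ... | inj₂ (L , isCode , decode≗) with code-surjective isCode
  ...   | es , d , refl = cnf es d , segmentOf≐ {cnf es d} {F} decode≗

module _ (lem : ExcludedMiddle 0ℓ) where
  open Classical lem

  toOrd : FinalSeg → Ord
  toOrd F = proj₁ (segmentOf-surjective F)

  segmentOf-toOrd : ∀ F → segmentOf (toOrd F) ≐F F
  segmentOf-toOrd F = proj₂ (segmentOf-surjective F)

  toOrd-reflects : ∀ {F G} → toOrd F ≤O toOrd G → F ⊴ G
  toOrd-reflects {F} {G} =
    ⊴-resp-≐F {segmentOf (toOrd F)} {F} {segmentOf (toOrd G)} {G}
              (segmentOf-toOrd F) (segmentOf-toOrd G)
    ∘ segmentOf-mono

  toOrd-mono : ∀ {F G} → F ⊴ G → toOrd F ≤O toOrd G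
  toOrd-mono {F} {G} =
    segmentOf-reflects
    ∘ ⊴-resp-≐F {F} {segmentOf (toOrd F)} {G} {segmentOf (toOrd G)}
                (≐-sym (segmentOf-toOrd F)) (≐-sym (segmentOf-toOrd G))

  toOrd-strict : ∀ {F G} → F ◁ G → toOrd F <O toOrd G
  toOrd-strict {F} {G} (F⊴G , F≉G) with ≤O⇒≈O⊎<O {toOrd F} {toOrd G} (toOrd-mono {F} {G} F⊴G)
  ... | inj₂ lt = lt
  ... | inj₁ eq = ⊥-elim (F≉G (≐-trans (≐-sym (segmentOf-toOrd F))
                       (≐-trans (segmentOf-cong {toOrd F} {toOrd G} eq) (segmentOf-toOrd G))))

  finalSeg≅ord : OrderIso _≐F_ _⊴_ _≈O_ _≤O_
  finalSeg≅ord = record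
    { to = toOrd
    ; from = segmentOf
    ; to-from = λ x → segmentOf-injective (segmentOf-toOrd (segmentOf x))
    ; from-to = segmentOf-toOrd
    ; mono = λ {F} {G} → toOrd-mono {F} {G}
    ; reflects = λ {F} {G} → toOrd-reflects {F} {G}
    }

  ⊴-isTotalOrder : IsTotalOrder _≐F_ _⊴_
  ⊴-isTotalOrder = record
    { isPartialOrder = ⊴-isPartialOrder
    ; total = λ F G → Sum.map toOrd-reflects toOrd-reflects (≤O-total (toOrd F) (toOrd G))
    }

  ◁-wellFounded : WellFounded _◁_
  ◁-wellFounded =
    Subrelation.wellFounded (λ {F} {G} → toOrd-strict {F} {G}) (On.wellFounded toOrd <O-wellFounded)

lemma4p3 : ExcludedMiddle 0ℓ →
    IsWellOrder _≐F_ _⊴_ × OrderIso _≐F_ _⊴_ _≈O_ _≤O_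
lemma4p3 lem = (⊴-isTotalOrder lem , ◁-wellFounded lem) , finalSeg≅ord lem
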